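{- Let $u=(1,0)$, $v=(1/2,\sqrt3/2)$ and let $G$ be the graph of the periodic tiling of the plane by unit equilateral triangles: its vertices are the points $(a,b):=au+bv$ with $a,b\in\mathbb{Z}$, and its edges are the pairs $\{(a,b),(a+1,b)\}$, $\{(a,b),(a,b+1)\}$ and $\{(a,b),(a-1,b+1)\}$ for $a,b\in\mathbb{Z}$. For $x\in\mathbb{Z}$ put $[x]=(x \bmod 3)+1\in\{1,2,3\}$, and define $w:E\to\{1,2,3\}$ by $w(\{(a,b),(a+1,b)\})=[a-b]$, $w(\{(a,b),(a,b+1)\})=[a-b+2]$, $w(\{(a,b),(a-1,b+1)\})=[a-b]$. (This is the weighting obtained by tiling the plane periodically with a rhombus made of 18 triangles, labeled as in the paper.) Then $w$ is a solution to the 1-2-3 problem for $G$.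
   Context: For a graph $G=(V,E)$ and $w:E\to\{1,2,3\}$, the weighted degree of a vertex $p$ is $s_w(p)=\sum_{pq\in E}w(pq)$; $w$ is a solution to the 1-2-3 problem if $s_w(p)\neq s_w(q)$ for every edge $pq$. -}

module Defs where

open import Data.Integer using (ℤ; +_; _+_; _-_; _%ℕ_; 1ℤ)
open import Data.Nat using (ℕ) renaming (_+_ to _+ℕ_)
open import Data.Product using (_×_; _,_)
open import Data.List using (List; _∷_; []; map)
open import Data.Nat.ListAction using (sum)
open import Relation.Binary.PropositionalEquality using (_≢_)

-- Vertices of the triangular lattice: (a,b) stands for a·u + b·v.
Vertex : Set
Vertex = ℤ × ℤ

data Dir : Set where
  dirU dirV dirVU : Dir

step : Dir → Vertex → Vertex
step dirU  (a , b) = (a + 1ℤ , b)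
step dirV  (a , b) = (a , b + 1ℤ)
step dirVU (a , b) = (a - 1ℤ , b + 1ℤ)

-- Every edge of G is uniquely represented by a pair (p , d), meaning the
-- edge {p , step d p}.
Edge : Set
Edge = Vertex × Dir

data Adj : Vertex → Vertex → Set where
  fwd : ∀ p d → Adj p (step d p)
  bwd : ∀ p d → Adj (step d p) p

br : ℤ → ℕ
br x = (x %ℕ 3) +ℕ 1

w : Edge → ℕ
w ((a , b) , dirU)  = br (a - b)
w ((a , b) , dirV)  = br (a - b + + 2)
w ((a , b) , dirVU) = br (a - b)

-- The edges incident to p: for each direction d, the edge (p , d) and
-- the edge (p - d , d) ending at p. These are exactly the 6 edges at p.
incident : Vertex → List Edge
incident (a , b) =
  ((a , b) , dirU)  ∷ ((a , b) , dirV)  ∷ ((a , b) , dirVU) ∷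
  ((a - 1ℤ , b) , dirU) ∷ ((a , b - 1ℤ) , dirV) ∷ ((a + 1ℤ , b - 1ℤ) , dirVU) ∷ []

s : (Edge → ℕ) → Vertex → ℕ
s wt p = sum (map wt (incident p))

Is123Solution : (Edge → ℕ) → Set
Is123Solution wt = ∀ p q → Adj p q → s wt p ≢ s wt q

-- Every weight, hence every weighted degree, depends only on the level a − b of a
-- vertex modulo 3: a vertex at level x has three incident edges of weight [x] and
-- three of weight [x + 2], so s_w takes the values 12, 9, 15 on the residues 0, 1, 2.
-- The endpoints of an edge have levels differing by 1 or 2, i.e. different
-- residues, hence different weighted degrees.
module Submission where

open import Defs
open import Data.Integer using (ℤ; +_; -[1+_]; _+_; _-_; _%ℕ_; 1ℤ)
open import Data.Integer.DivMod using (n%ℕd<d)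
open import Data.Integer.Properties using (+-identityʳ; pos-+)
open import Data.Integer.Tactic.RingSolver using (solve-∀)
open import Data.Nat using (ℕ; zero; suc; _<_; _%_; _/_; NonZero; s<s)
  renaming (_+_ to _+ℕ_; _*_ to _*ℕ_)
open import Data.Nat.DivMod using (m≡m%n+[m/n]*n; [m+kn]%n≡m%n; [m+n]%n≡m%n; m<n⇒m%n≡m; m%n<n; %-distribˡ-+)
import Data.Nat.Properties as ℕ
import Data.Nat.Tactic.RingSolver as ℕ-Ring
open import Data.Product using (_,_)
open import Relation.Binary.PropositionalEquality
  using (_≡_; _≢_; refl; sym; trans; cong; ≢-sym; module ≡-Reasoning)

suc-% : ∀ m d .{{_ : NonZero d}} → suc m % d ≡ suc (m % d) % d
suc-% m d = begin
  suc m % d                              ≡⟨ cong (λ n → suc n % d) (m≡m%n+[m/n]*n m d) ⟩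
  (suc (m % d) +ℕ (m / d) *ℕ d) % d      ≡⟨ [m+kn]%n≡m%n (suc (m % d)) (m / d) d ⟩
  suc (m % d) % d                        ∎
  where open ≡-Reasoning

%ℕ3-suc : ∀ x → (x + 1ℤ) %ℕ 3 ≡ suc (x %ℕ 3) % 3
%ℕ3-suc (+ n) = trans (cong (_% 3) (ℕ.+-comm n 1)) (suc-% n 3)
%ℕ3-suc -[1+ zero ] = refl
%ℕ3-suc -[1+ suc n ] with suc n % 3 | m%n<n (suc n) 3 | suc-% (suc n) 3
... | 0 | _ | eq rewrite eq = refl
... | 1 | _ | eq rewrite eq = refl
... | 2 | _ | eq rewrite eq = refl
... | suc (suc (suc _)) | s<s (s<s (s<s ())) | _

%ℕ3-+ : ∀ x k → (x + + k) %ℕ 3 ≡ (x %ℕ 3 +ℕ k) % 3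
%ℕ3-+ x zero = begin
  (x + + 0) %ℕ 3    ≡⟨ cong (_%ℕ 3) (+-identityʳ x) ⟩
  x %ℕ 3            ≡⟨ m<n⇒m%n≡m (n%ℕd<d x 3) ⟨
  x %ℕ 3 % 3        ≡⟨ cong (_% 3) (ℕ.+-identityʳ (x %ℕ 3)) ⟨
  (x %ℕ 3 +ℕ 0) % 3 ∎
  where open ≡-Reasoning
%ℕ3-+ x (suc k) = begin
  (x + + suc k) %ℕ 3           ≡⟨ cong (_%ℕ 3) (trans (cong (_+_ x) (pos-+ 1 k)) (regroup x (+ k))) ⟩
  (x + + k + 1ℤ) %ℕ 3          ≡⟨ %ℕ3-suc (x + + k) ⟩
  suc ((x + + k) %ℕ 3) % 3     ≡⟨ cong (λ r → suc r % 3) (%ℕ3-+ x k) ⟩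
  suc ((x %ℕ 3 +ℕ k) % 3) % 3  ≡⟨ suc-% (x %ℕ 3 +ℕ k) 3 ⟨
  suc (x %ℕ 3 +ℕ k) % 3        ≡⟨ cong (_% 3) (ℕ.+-suc (x %ℕ 3) k) ⟨
  (x %ℕ 3 +ℕ suc k) % 3        ∎
  where
  open ≡-Reasoning
  regroup : ∀ x y → x + (1ℤ + y) ≡ x + y + 1ℤ
  regroup = solve-∀

%ℕ3-periodic : ∀ x → (x + + 3) %ℕ 3 ≡ x %ℕ 3
%ℕ3-periodic x = begin
  (x + + 3) %ℕ 3     ≡⟨ %ℕ3-+ x 3 ⟩
  (x %ℕ 3 +ℕ 3) % 3  ≡⟨ [m+n]%n≡m%n (x %ℕ 3) 3 ⟩
  x %ℕ 3 % 3         ≡⟨ m<n⇒m%n≡m (n%ℕd<d x 3) ⟩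
  x %ℕ 3             ∎
  where open ≡-Reasoning

%ℕ3-pred : ∀ x → (x - 1ℤ) %ℕ 3 ≡ (x + + 2) %ℕ 3
%ℕ3-pred x = trans (sym (%ℕ3-periodic (x - 1ℤ))) (cong (_%ℕ 3) (shift x))
  where
  shift : ∀ x → x - 1ℤ + + 3 ≡ x + + 2
  shift = solve-∀

rotate-≢ : ∀ {r k} → r < 3 → k < 3 → k ≢ 0 → (r +ℕ k) % 3 ≢ r
rotate-≢ {_} {0} _ _ k≢0 _ = k≢0 refl
rotate-≢ {0} {1} _ _ _ ()
rotate-≢ {0} {2} _ _ _ ()
rotate-≢ {1} {1} _ _ _ ()
rotate-≢ {1} {2} _ _ _ ()
rotate-≢ {2} {1} _ _ _ ()
rotate-≢ {2} {2} _ _ _ ()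
rotate-≢ {suc (suc (suc _))} (s<s (s<s (s<s ())))
rotate-≢ {_} {suc (suc (suc _))} _ (s<s (s<s (s<s ())))

%ℕ3-shift-≢ : ∀ x k → k % 3 ≢ 0 → (x + + k) %ℕ 3 ≢ x %ℕ 3
%ℕ3-shift-≢ x k k≢0 eq = rotate-≢ (n%ℕd<d x 3) (m%n<n k 3) k≢0 (begin
  (x %ℕ 3 +ℕ k % 3) % 3     ≡⟨ cong (λ r → (r +ℕ k % 3) % 3) (m<n⇒m%n≡m (n%ℕd<d x 3)) ⟨
  (x %ℕ 3 % 3 +ℕ k % 3) % 3 ≡⟨ %-distribˡ-+ (x %ℕ 3) k 3 ⟨
  (x %ℕ 3 +ℕ k) % 3         ≡⟨ %ℕ3-+ x k ⟨
  (x + + k) %ℕ 3            ≡⟨ eq ⟩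
  x %ℕ 3                    ∎)
  where open ≡-Reasoning

level : Vertex → ℤ
level (a , b) = a - b

degree : ℕ → ℕ
degree r = 3 *ℕ (r +ℕ 1) +ℕ 3 *ℕ ((r +ℕ 2) % 3 +ℕ 1)

degree-injective : ∀ {r r′} → r < 3 → r′ < 3 → degree r ≡ degree r′ → r ≡ r′
degree-injective {0} {0} _ _ _ = refl
degree-injective {1} {1} _ _ _ = refl
degree-injective {2} {2} _ _ _ = refl
degree-injective {0} {1} _ _ ()
degree-injective {0} {2} _ _ ()
degree-injective {1} {0} _ _ ()
degree-injective {1} {2} _ _ ()
degree-injective {2} {0} _ _ ()
degree-injective {2} {1} _ _ ()
degree-injective {suc (suc (suc _))} (s<s (s<s (s<s ())))
degree-injective {_} {suc (suc (suc _))} _ (s<s (s<s (s<s ())))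

private
  level-west : ∀ a b → a - 1ℤ - b ≡ a - b - 1ℤ
  level-west = solve-∀
  level-south : ∀ a b → a - (b - 1ℤ) + + 2 ≡ a - b + + 3
  level-south = solve-∀
  level-southeast : ∀ a b → a + 1ℤ - (b - 1ℤ) ≡ a - b + + 2
  level-southeast = solve-∀
  level-east : ∀ a b → a + 1ℤ - b ≡ a - b + + 1
  level-east = solve-∀
  level-north : ∀ a b → a - b ≡ a - (b + 1ℤ) + + 1
  level-north = solve-∀
  level-northwest : ∀ a b → a - b ≡ a - 1ℤ - (b + 1ℤ) + + 2
  level-northwest = solve-∀

s-w≡degree : ∀ p → s w p ≡ degree (level p %ℕ 3)
s-w≡degree (a , b)
  rewrite level-west a b | level-south a b | level-southeast a b
        | %ℕ3-pred (a - b) | %ℕ3-periodic (a - b) | %ℕ3-+ (a - b) 2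
  = three-pairs ((a - b) %ℕ 3 +ℕ 1) (((a - b) %ℕ 3 +ℕ 2) % 3 +ℕ 1)
  where
  three-pairs : ∀ u v → u +ℕ (v +ℕ (u +ℕ (v +ℕ (u +ℕ (v +ℕ 0))))) ≡ 3 *ℕ u +ℕ 3 *ℕ v
  three-pairs = ℕ-Ring.solve-∀

s-w-≢-level-shift : ∀ p q k → k % 3 ≢ 0 → level q ≡ level p + + k → s w p ≢ s w q
s-w-≢-level-shift p q k k≢0 level-q s-p≡s-q =
  %ℕ3-shift-≢ (level p) k k≢0 (begin
    (level p + + k) %ℕ 3  ≡⟨ cong (_%ℕ 3) level-q ⟨
    level q %ℕ 3          ≡⟨ degree-injective (n%ℕd<d (level q) 3) (n%ℕd<d (level p) 3) same-degree ⟩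
    level p %ℕ 3          ∎)
  where
  open ≡-Reasoning
  same-degree : degree (level q %ℕ 3) ≡ degree (level p %ℕ 3)
  same-degree = trans (sym (s-w≡degree q)) (trans (sym s-p≡s-q) (s-w≡degree p))

s-w-≢-step : ∀ p d → s w p ≢ s w (step d p)
s-w-≢-step (a , b) dirU  = s-w-≢-level-shift (a , b) (a + 1ℤ , b) 1 (λ ()) (level-east a b)
s-w-≢-step (a , b) dirV  = ≢-sym (s-w-≢-level-shift (a , b + 1ℤ) (a , b) 1 (λ ()) (level-north a b))
s-w-≢-step (a , b) dirVU = ≢-sym (s-w-≢-level-shift (a - 1ℤ , b + 1ℤ) (a , b) 2 (λ ()) (level-northwest a b))

proposition3p4 : Is123Solution w
proposition3p4 p .(step d p) (fwd p d) = s-w-≢-step p d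
proposition3p4 .(step d q) q (bwd q d) = ≢-sym (s-w-≢-step q d)
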